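{- Let $L$ and $M$ be bounded lattices, with bounds $0_L,1_L$ and $0_M,1_M$ respectively. Let $r: L \to M$ be a retraction with pseudo-inverse $s: M \to L$, i.e. $r$ is a lattice homomorphism, $s$ is a lattice monomorphism, and $r\circ s = \mathrm{Id}_M$. Suppose that for all $x \in L$: $r(x) = 0_M \Leftrightarrow x = 0_L$, and $r(x) = 1_M \Leftrightarrow x = 1_L$. Let $O: M^2 \to M$ be a quasi-overlap function on $M$. Then the function $O^{E}: L^2 \to L$ defined by $O^{E}(x,y) = s(O(r(x), r(y)))$ is a quasi-overlap function on $L$ which extends $O$ from $M$ to $L$, i.e. $O^{E}\circ(s\times s) = s\circ O$ (that is, $O^E(s(x),s(y)) = s(O(x,y))$ for all $x,y\in M$).
   Context: A quasi-overlap function on a bounded lattice $L$ is a map $O: L^2\to L$ such that for all $x,y,z\in L$: (i) $O(x,y)=O(y,x)$; (ii) $O(x,y)=0_L$ iff $x=0_L$ or $y=0_L$; (iii) $O(x,y)=1_L$ iff $x=1_L$ and $y=1_L$; (iv) $O(x,y)\le_L O(x,z)$ whenever $y\le_L z$. Following Palmeira and Bedregal, $M$ is regarded as a (generalized) sublattice of $L$ via a lattice monomorphism $s: M\to L$; a retraction is a lattice homomorphism $r: L\to M$ for which there exists a monomorphism $s: M\to L$ (its pseudo-inverse) with $r\circ s=\mathrm{Id}_M$. Lattice homomorphisms preserve binary meets and joins (hence are increasing). -}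

module Defs where

open import Level using (Level; _⊔_)
open import Data.Product using (_×_)
open import Data.Sum using (_⊎_)
open import Relation.Binary.Lattice.Bundles using (BoundedLattice)

private
  variable
    a b ℓ₁ ℓ₂ ℓ₃ ℓ₄ : Level

record IsQuasiOverlap (L : BoundedLattice a ℓ₁ ℓ₂)
                      (O : BoundedLattice.Carrier L → BoundedLattice.Carrier L → BoundedLattice.Carrier L)
                      : Set (a ⊔ ℓ₁ ⊔ ℓ₂) where
  open BoundedLattice L
  field
    comm  : ∀ x y → O x y ≈ O y x
    zero⇒ : ∀ x y → O x y ≈ ⊥ → (x ≈ ⊥ ⊎ y ≈ ⊥)
    ⇒zero : ∀ x y → (x ≈ ⊥ ⊎ y ≈ ⊥) → O x y ≈ ⊥
    one⇒  : ∀ x y → O x y ≈ ⊤ → (x ≈ ⊤ × y ≈ ⊤)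
    ⇒one  : ∀ x y → (x ≈ ⊤ × y ≈ ⊤) → O x y ≈ ⊤
    mono  : ∀ x y z → y ≤ z → O x y ≤ O x z

record IsLatticeHom (L : BoundedLattice a ℓ₁ ℓ₂) (M : BoundedLattice b ℓ₃ ℓ₄)
                    (f : BoundedLattice.Carrier L → BoundedLattice.Carrier M)
                    : Set (a ⊔ ℓ₁ ⊔ ℓ₃) where
  private
    module L = BoundedLattice L
    module M = BoundedLattice M
  field
    cong   : ∀ {x y} → x L.≈ y → f x M.≈ f y
    pres-∧ : ∀ x y → f (x L.∧ y) M.≈ (f x M.∧ f y)
    pres-∨ : ∀ x y → f (x L.∨ y) M.≈ (f x M.∨ f y)

record IsLatticeMono (L : BoundedLattice a ℓ₁ ℓ₂) (M : BoundedLattice b ℓ₃ ℓ₄)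
                     (f : BoundedLattice.Carrier L → BoundedLattice.Carrier M)
                     : Set (a ⊔ ℓ₁ ⊔ ℓ₃) where
  private
    module L = BoundedLattice L
    module M = BoundedLattice M
  field
    isHom     : IsLatticeHom L M f
    injective : ∀ {x y} → f x M.≈ f y → x L.≈ y

extendQO : (L : BoundedLattice a ℓ₁ ℓ₂) (M : BoundedLattice b ℓ₃ ℓ₄)
           (r : BoundedLattice.Carrier L → BoundedLattice.Carrier M)
           (s : BoundedLattice.Carrier M → BoundedLattice.Carrier L)
           (O : BoundedLattice.Carrier M → BoundedLattice.Carrier M → BoundedLattice.Carrier M)
           → BoundedLattice.Carrier L → BoundedLattice.Carrier L → BoundedLattice.Carrier L
extendQO L M r s O x y = s (O (r x) (r y))

-- Since r ∘ s is the identity, s O(r x, r y) is ⊥ (resp. ⊤) exactly when O(r x, r y) is, hence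
-- exactly when r x or r y is ⊥ (resp. both are ⊤), and the hypotheses on r transfer this back
-- to x and y. Commutativity and monotonicity pass through the monotone maps r and s, and on the
-- image of s the extension collapses to s ∘ O because r (s x) ≈ x.
module Submission where

open import Defs
open import Level using (Level)
open import Data.Product using (_×_; _,_) renaming (map to map-×)
open import Data.Sum using () renaming (map to map-⊎)
open import Function.Base using (_∘′_)
open import Function.Bundles using (_⇔_; Equivalence; mk⇔)
open import Relation.Binary.Lattice.Bundles using (BoundedLattice)
import Relation.Binary.Lattice.Properties.JoinSemilattice as JoinSemilatticeProperties
import Relation.Binary.Reasoning.PartialOrder as ≤-Reasoning
import Relation.Binary.Reasoning.Setoid as ≈-Reasoning

private
  variable
    a b ℓ₁ ℓ₂ ℓ₃ ℓ₄ : Level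

module _ (L : BoundedLattice a ℓ₁ ℓ₂) (M : BoundedLattice b ℓ₃ ℓ₄) where
  private
    module L = BoundedLattice L
    module M = BoundedLattice M

  IsLatticeHom⇒monotone : ∀ {f} → IsLatticeHom L M f → ∀ {x y} → x L.≤ y → f x M.≤ f y
  IsLatticeHom⇒monotone {f} hom {x} {y} x≤y = begin
    f x         ≤⟨ M.x≤x∨y (f x) (f y) ⟩
    f x M.∨ f y ≈⟨ M.Eq.sym (pres-∨ x y) ⟩
    f (x L.∨ y) ≈⟨ cong (JoinSemilatticeProperties.x≤y⇒x∨y≈y L.joinSemilattice x≤y) ⟩
    f y         ∎
    where
    open IsLatticeHom hom
    open ≤-Reasoning M.poset

  section-fibre-⇔ : (r : L.Carrier → M.Carrier) (s : M.Carrier → L.Carrier) →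
                    (∀ m → r (s m) M.≈ m) →
                    ∀ {c d} → (∀ x → r x M.≈ c ⇔ x L.≈ d) →
                    ∀ m → s m L.≈ d ⇔ m M.≈ c
  section-fibre-⇔ r s r∘s≈id r⁻¹c≈d m = mk⇔
    (λ sm≈d → M.Eq.trans (M.Eq.sym (r∘s≈id m)) (Equivalence.from (r⁻¹c≈d (s m)) sm≈d))
    (λ m≈c → Equivalence.to (r⁻¹c≈d (s m)) (M.Eq.trans (r∘s≈id m) m≈c))

module _ {M : BoundedLattice b ℓ₃ ℓ₄} {O : BoundedLattice.Carrier M → BoundedLattice.Carrier M → BoundedLattice.Carrier M}
         (qo : IsQuasiOverlap M O) where
  private
    module M = BoundedLattice M
  open IsQuasiOverlap qo

  quasiOverlap-congʳ : ∀ x {y z} → y M.≈ z → O x y M.≈ O x z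
  quasiOverlap-congʳ x {y} {z} y≈z =
    M.antisym (mono x y z (M.reflexive y≈z)) (mono x z y (M.reflexive (M.Eq.sym y≈z)))

  quasiOverlap-cong : ∀ {x x′ y y′} → x M.≈ x′ → y M.≈ y′ → O x y M.≈ O x′ y′
  quasiOverlap-cong {x} {x′} {y} {y′} x≈x′ y≈y′ = begin
    O x y   ≈⟨ quasiOverlap-congʳ x y≈y′ ⟩
    O x y′  ≈⟨ comm x y′ ⟩
    O y′ x  ≈⟨ quasiOverlap-congʳ y′ x≈x′ ⟩
    O y′ x′ ≈⟨ comm y′ x′ ⟩
    O x′ y′ ∎
    where open ≈-Reasoning M.setoid

module _ (L : BoundedLattice a ℓ₁ ℓ₂) (M : BoundedLattice b ℓ₃ ℓ₄)
         (r : BoundedLattice.Carrier L → BoundedLattice.Carrier M)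
         (s : BoundedLattice.Carrier M → BoundedLattice.Carrier L)
         (r∘s≈id : ∀ m → BoundedLattice._≈_ M (r (s m)) m)
         {O : BoundedLattice.Carrier M → BoundedLattice.Carrier M → BoundedLattice.Carrier M}
         (qo : IsQuasiOverlap M O) where
  private
    module L = BoundedLattice L
    module M = BoundedLattice M
    module O = IsQuasiOverlap qo

  extendQO-extends : IsLatticeHom M L s →
                     ∀ x y → extendQO L M r s O (s x) (s y) L.≈ s (O x y)
  extendQO-extends s-hom x y = IsLatticeHom.cong s-hom (quasiOverlap-cong qo (r∘s≈id x) (r∘s≈id y))

  extendQO-isQuasiOverlap : IsLatticeHom L M r → IsLatticeHom M L s →
                            (∀ x → r x M.≈ M.⊥ ⇔ x L.≈ L.⊥) →
                            (∀ x → r x M.≈ M.⊤ ⇔ x L.≈ L.⊤) →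
                            IsQuasiOverlap L (extendQO L M r s O)
  extendQO-isQuasiOverlap r-hom s-hom r-detects-⊥ r-detects-⊤ = record
    { comm  = λ x y → IsLatticeHom.cong s-hom (O.comm (r x) (r y))
    ; zero⇒ = λ x y → map-⊎ (to (r-detects-⊥ x)) (to (r-detects-⊥ y)) ∘′ O.zero⇒ (r x) (r y) ∘′ to (s-detects-⊥ _)
    ; ⇒zero = λ x y → from (s-detects-⊥ _) ∘′ O.⇒zero (r x) (r y) ∘′ map-⊎ (from (r-detects-⊥ x)) (from (r-detects-⊥ y))
    ; one⇒  = λ x y → map-× (to (r-detects-⊤ x)) (to (r-detects-⊤ y)) ∘′ O.one⇒ (r x) (r y) ∘′ to (s-detects-⊤ _)
    ; ⇒one  = λ x y → from (s-detects-⊤ _) ∘′ O.⇒one (r x) (r y) ∘′ map-× (from (r-detects-⊤ x)) (from (r-detects-⊤ y))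
    ; mono  = λ x y z y≤z → IsLatticeHom⇒monotone M L s-hom
                              (O.mono (r x) (r y) (r z) (IsLatticeHom⇒monotone L M r-hom y≤z))
    }
    where
    open Equivalence
    s-detects-⊥ : ∀ m → s m L.≈ L.⊥ ⇔ m M.≈ M.⊥
    s-detects-⊥ = section-fibre-⇔ L M r s r∘s≈id r-detects-⊥
    s-detects-⊤ : ∀ m → s m L.≈ L.⊤ ⇔ m M.≈ M.⊤
    s-detects-⊤ = section-fibre-⇔ L M r s r∘s≈id r-detects-⊤

theorem1 : ∀ {a b ℓ₁ ℓ₂ ℓ₃ ℓ₄ : Level}
    (L : BoundedLattice a ℓ₁ ℓ₂) (M : BoundedLattice b ℓ₃ ℓ₄)
    (r : BoundedLattice.Carrier L → BoundedLattice.Carrier M)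
    (s : BoundedLattice.Carrier M → BoundedLattice.Carrier L)
    → IsLatticeHom L M r
    → IsLatticeMono M L s
    → (∀ x → BoundedLattice._≈_ M (r (s x)) x)
    → (∀ x → (BoundedLattice._≈_ M (r x) (BoundedLattice.⊥ M)) ⇔ (BoundedLattice._≈_ L x (BoundedLattice.⊥ L)))
    → (∀ x → (BoundedLattice._≈_ M (r x) (BoundedLattice.⊤ M)) ⇔ (BoundedLattice._≈_ L x (BoundedLattice.⊤ L)))
    → (O : BoundedLattice.Carrier M → BoundedLattice.Carrier M → BoundedLattice.Carrier M)
    → IsQuasiOverlap M O
    → IsQuasiOverlap L (extendQO L M r s O)
      × (∀ x y → BoundedLattice._≈_ L (extendQO L M r s O (s x) (s y)) (s (O x y)))
theorem1 L M r s r-hom s-mono r∘s≈id r-detects-⊥ r-detects-⊤ O qo =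
  extendQO-isQuasiOverlap L M r s r∘s≈id qo r-hom s-hom r-detects-⊥ r-detects-⊤ ,
  extendQO-extends L M r s r∘s≈id qo s-hom
  where s-hom = IsLatticeMono.isHom s-mono
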